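{- For every $r, s \geq 1$ there exists a $((r-1)^{2^{s-1}}, s)$-formation that avoids every binary $(r, s)$-formation.
   Context: A sequence $s$ contains a sequence $u$ if some subsequence of $s$ can be changed into $u$ by a one-to-one renaming of its letters; otherwise it avoids $u$. An $(r,s)$-formation is a concatenation of $s$ permutations of the same set of $r$ distinct letters. An $(r,s)$-formation $f$ is binary if there is a permutation $p$ of its $r$ letters such that every permutation in $f$ is either $p$ or the reverse of $p$. -}

module Defs where

open import Data.Nat using (ℕ)
open import Data.List using (List; map; concat; length; reverse)
open import Data.List.Relation.Unary.All using (All)
open import Data.List.Relation.Unary.Unique.Propositional using (Unique)
open import Data.List.Relation.Binary.Sublist.Propositional using (_⊆_)
open import Data.List.Relation.Binary.Permutation.Propositional using (_↭_)
open import Data.List.Membership.Propositional using (_∈_)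
open import Data.Product using (Σ; _×_; ∃)
open import Data.Sum using (_⊎_)
open import Relation.Binary.PropositionalEquality using (_≡_)
open import Relation.Nullary using (¬_)

Seq : Set
Seq = List ℕ

Contains : Seq → Seq → Set
Contains s u =
  Σ Seq λ t → (t ⊆ s) ×
    Σ (ℕ → ℕ) λ f → (map f t ≡ u) ×
      (∀ {x y} → x ∈ t → y ∈ t → f x ≡ f y → x ≡ y)

Avoids : Seq → Seq → Set
Avoids s u = ¬ Contains s u

IsFormation : ℕ → ℕ → Seq → Set
IsFormation r s f =
  Σ Seq λ p → Unique p × (length p ≡ r) ×
    Σ (List Seq) λ blocks → (length blocks ≡ s) ×
      All (λ b → b ↭ p) blocks × (f ≡ concat blocks)

IsBinaryFormation : ℕ → ℕ → Seq → Set
IsBinaryFormation r s f =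
  Σ Seq λ p → Unique p × (length p ≡ r) ×
    Σ (List Seq) λ blocks → (length blocks ≡ s) ×
      All (λ b → (b ≡ p) ⊎ (b ≡ reverse p)) blocks × (f ≡ concat blocks)

-- Call a list q monotone in a block b if its letters occur in b in the order of q or in the
-- reverse order. If f = B₁ ⋯ B_s contains a binary (r,s)-formation, then cutting the embedded
-- subsequence along the blocks gives one r-letter list that is monotone in every block.
-- Starting from the single block 0 1 ⋯ (k-1), which admits no monotone list of k+1 letters,
-- replace the blocks B₁ ⋯ B_s over the ground set X by
--   X × reverse X,  B₁ × B₁, …, B_s × B_s
-- (lexicographic products, X being one of the B_i). The ground set is squared and one block is
-- added, which gives the parameters ((r-1)^(2^(s-1)), s). A common monotone list of pairs must
-- either have pairwise distinct first coordinates (if its orientations in X × reverse X and in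
-- X × X agree) or a constant first coordinate (if they disagree); projecting to the first,
-- resp. second, coordinates then yields a common monotone list for B₁, …, B_s.
module Submission where

open import Defs
open import Data.Bool using (Bool; true; false; not)
open import Data.Nat using (ℕ; zero; suc; _+_; _*_; _≤_; _<_; _≥_; _∸_; _^_; NonZero; z≤n; s≤s)
open import Data.Nat.Properties
  using (≤-trans; ≤-antisym; ≤-reflexive; +-mono-≤; +-monoʳ-≤; +-monoˡ-<; +-cancelʳ-≤; *-monoˡ-≤; *-identityʳ;
         +-identityʳ; suc-injective; <⇒≱; m<n⇒m<1+n; m*n≢0; ^-distribˡ-+-*; module ≤-Reasoning)
open import Data.Nat.DivMod using (_/_; _%_; +-distrib-/-∣ʳ; m<n⇒m/n≡0; m*n/n≡m; [m+kn]%n≡m%n; m<n⇒m%n≡m)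
open import Data.Nat.Divisibility using (n∣m*n)
open import Data.Product using (Σ; ∃; ∃₂; _×_; _,_; proj₁; proj₂)
open import Data.Sum using (_⊎_; inj₁; inj₂)
open import Data.Empty using (⊥; ⊥-elim)
open import Function using (id; _∘_)
open import Data.List using (List; []; _∷_; _++_; map; concat; length; reverse; upTo; cartesianProduct)
open import Data.List.Properties
  using (∷-injective; length-++; length-++-sucʳ; length-map; length-reverse; length-upTo; map-∘; map-id-local;
         concat-map; reverse-involutive; reverse-map)
open import Data.List.Membership.Propositional using (_∈_)
open import Data.List.Membership.Propositional.Properties
  using (∈-map⁺; ∈-map⁻; ∈-++⁺ˡ; ∈-++⁺ʳ; ∈-++⁻; ∈-∃++; ∈-upTo⁻; ∈-cartesianProduct⁻)
open import Data.List.Relation.Unary.Any using (here; there)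
open import Data.List.Relation.Unary.Any.Properties using (reverse⁻)
open import Data.List.Relation.Unary.All as All using (All; []; _∷_)
import Data.List.Relation.Unary.All.Properties as All
open import Data.List.Relation.Unary.AllPairs as AllPairs using (AllPairs; []; _∷_)
import Data.List.Relation.Unary.AllPairs.Properties as AllPairs
open import Data.List.Relation.Unary.Unique.Propositional using (Unique)
import Data.List.Relation.Unary.Unique.Propositional.Properties as Unique
open import Data.List.Relation.Binary.Sublist.Propositional using (_⊆_; []; _∷_; _∷ʳ_; ⊆-trans; to∈; from∈)
open import Data.List.Relation.Binary.Sublist.Propositional.Properties using (∷ˡ⁻; reverse⁺; map⁺; All-resp-⊆)
open import Data.List.Relation.Binary.Pointwise using (Pointwise; []; _∷_; Pointwise-length)
open import Data.List.Relation.Binary.Permutation.Propositional as ↭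
  using (_↭_; ↭-refl; ↭-sym; prep; swap; ↭⇒↭ₛ)
import Data.List.Relation.Binary.Permutation.Propositional.Properties as ↭
import Data.List.Relation.Binary.Permutation.Setoid.Properties as ↭ₛ
open import Relation.Binary.PropositionalEquality
  using (_≡_; _≢_; refl; sym; trans; cong; cong₂; subst; setoid; module ≡-Reasoning)
open import Relation.Nullary using (¬_)

private
  variable
    A B : Set
    a x y : A
    b p q t xs ys zs : List A
    bs ts : List (List A)
    r : ℕ

Before : List A → A → A → Set
Before b x y = x ∷ y ∷ [] ⊆ b

Ordered : List A → Bool → A → A → Set
Ordered b true  x y = Before b x y
Ordered b false x y = Before b y x

Before-irrefl : Unique b → ¬ Before b x x
Before-irrefl (_ ∷ u) (_ ∷ʳ τ) = Before-irrefl u τ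
Before-irrefl (x∉ ∷ _) (refl ∷ τ) = All.lookup x∉ (to∈ τ) refl

Before-asym : Unique b → Before b x y → ¬ Before b y x
Before-asym (_ ∷ u) (_ ∷ʳ τ) (_ ∷ʳ σ) = Before-asym u τ σ
Before-asym (x∉ ∷ _) (refl ∷ τ) (_ ∷ʳ σ) = All.lookup x∉ (to∈ (∷ˡ⁻ σ)) refl
Before-asym (y∉ ∷ _) (_ ∷ʳ τ) (refl ∷ σ) = All.lookup y∉ (to∈ (∷ˡ⁻ τ)) refl
Before-asym (x∉ ∷ _) (refl ∷ τ) (refl ∷ σ) = All.lookup x∉ (to∈ τ) refl

Before-reverse : Before (reverse b) x y → Before b y x
Before-reverse {b = b} τ = subst (_ ⊆_) (reverse-involutive b) (reverse⁺ τ)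

Ordered⇒≢ : ∀ o → Unique b → Ordered b o x y → x ≢ y
Ordered⇒≢ true  u τ refl = Before-irrefl u τ
Ordered⇒≢ false u τ refl = Before-irrefl u τ

Ordered-not : ∀ o → Unique b → Ordered b o x y → ¬ Ordered b (not o) x y
Ordered-not true  u τ σ = Before-asym u τ σ
Ordered-not false u τ σ = Before-asym u σ τ

Ordered-reverse : ∀ o → Ordered (reverse b) o x y → Ordered b (not o) x y
Ordered-reverse true  = Before-reverse
Ordered-reverse false = Before-reverse

Ordered-map : (f : A → B) → ∀ o → Ordered b o x y → Ordered (map f b) o (f x) (f y)
Ordered-map f true  = map⁺ f
Ordered-map f false = map⁺ f

AllPairs-resp-⊆ : {R : A → A → Set} → xs ⊆ ys → AllPairs R ys → AllPairs R xs
AllPairs-resp-⊆ [] _ = []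
AllPairs-resp-⊆ (_ ∷ʳ τ) (_ ∷ rys) = AllPairs-resp-⊆ τ rys
AllPairs-resp-⊆ (refl ∷ τ) (ry ∷ rys) = All-resp-⊆ τ ry ∷ AllPairs-resp-⊆ τ rys

AllPairs-Before : ∀ (xs : List A) → AllPairs (Before xs) xs
AllPairs-Before [] = []
AllPairs-Before (x ∷ xs) =
  All.tabulate (λ y∈xs → refl ∷ from∈ y∈xs) ∷ AllPairs.map (x ∷ʳ_) (AllPairs-Before xs)

Monotone : List A → List A → Set
Monotone b q = All (_∈ b) q × ∃ λ o → AllPairs (Ordered b o) q

NoCommonMonotone : ℕ → List (List A) → Set
NoCommonMonotone r bs = ∀ q → length q ≡ r → ¬ All (λ b → Monotone b q) bs

⊆⇒AllPairs-Before : xs ⊆ ys → AllPairs (Before ys) xs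
⊆⇒AllPairs-Before {xs = xs} τ = AllPairs.map (λ σ → ⊆-trans σ τ) (AllPairs-Before xs)

⊆⇒Monotone : q ⊆ b → Monotone b q
⊆⇒Monotone τ = All-resp-⊆ τ (All.tabulate id) , true , ⊆⇒AllPairs-Before τ

reverse⊆⇒Monotone : reverse q ⊆ b → Monotone b q
reverse⊆⇒Monotone {q = q} {b = b} τ =
  All.map reverse⁻ (All-resp-⊆ τ′ (All.tabulate id)) , false , AllPairs.map Before-reverse (⊆⇒AllPairs-Before τ′)
  where
  τ′ : q ⊆ reverse b
  τ′ = subst (_⊆ reverse b) (reverse-involutive q) (reverse⁺ τ)

Monotone-map : (f : A → B) → Monotone b q → Monotone (map f b) (map f q)
Monotone-map f (q∈ , o , ord) =
  All.map⁺ (All.map (∈-map⁺ f) q∈) , o , AllPairs.map⁺ (AllPairs.map (Ordered-map f o) ord)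

Unique⇒length≤ : Unique xs → All (_∈ ys) xs → length xs ≤ length ys
Unique⇒length≤ [] [] = z≤n
Unique⇒length≤ {xs = x ∷ xs} (x∉xs ∷ u) (x∈ys ∷ xs⊆ys) with ∈-∃++ x∈ys
... | ys₁ , ys₂ , refl = subst (suc (length xs) ≤_) (sym (length-++-sucʳ ys₁ x ys₂))
  (s≤s (Unique⇒length≤ u (All.zipWith remove (x∉xs , xs⊆ys))))
  where
  remove : ∀ {y} → x ≢ y × y ∈ ys₁ ++ x ∷ ys₂ → y ∈ ys₁ ++ ys₂
  remove (x≢y , y∈) with ∈-++⁻ ys₁ y∈
  ... | inj₁ y∈ys₁ = ∈-++⁺ˡ y∈ys₁
  ... | inj₂ (here y≡x) = ⊥-elim (x≢y (sym y≡x))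
  ... | inj₂ (there y∈ys₂) = ∈-++⁺ʳ ys₁ y∈ys₂

Monotone⇒length≤ : Unique b → Monotone b q → length q ≤ length b
Monotone⇒length≤ u (q∈ , o , ord) = Unique⇒length≤ (AllPairs.map (Ordered⇒≢ o u) ord) q∈

singleton-noCommonMonotone : Unique b → length b < r → NoCommonMonotone r (b ∷ [])
singleton-noCommonMonotone {b = b} u lt q q-length (mono ∷ []) =
  <⇒≱ lt (subst (_≤ length b) q-length (Monotone⇒length≤ u mono))

InjectiveOn : (A → B) → List A → Set
InjectiveOn f zs = ∀ {x y} → x ∈ zs → y ∈ zs → f x ≡ f y → x ≡ y

Unique-map-injectiveOn : {f : A → B} → InjectiveOn f xs → Unique xs → Unique (map f xs)
Unique-map-injectiveOn inj [] = []
Unique-map-injectiveOn {xs = x ∷ xs} {f = f} inj (x∉xs ∷ u) =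
  All.map⁺ (All.tabulate (λ y∈xs fx≡fy → All.lookup x∉xs y∈xs (inj (here refl) (there y∈xs) fx≡fy)))
  ∷ Unique-map-injectiveOn (λ x∈ y∈ → inj (there x∈) (there y∈)) u

map-injectiveOn : {f : A → B} → InjectiveOn f zs → All (_∈ zs) xs → All (_∈ zs) ys →
  map f xs ≡ map f ys → xs ≡ ys
map-injectiveOn inj [] [] _ = refl
map-injectiveOn inj (x∈ ∷ xs∈) (y∈ ∷ ys∈) eq with ∷-injective eq
... | fx≡fy , eq′ = cong₂ _∷_ (inj x∈ y∈ fx≡fy) (map-injectiveOn inj xs∈ ys∈ eq′)

map-leftInverse : {f : A → B} {g : B → A} → All (λ x → g (f x) ≡ x) xs → map g (map f xs) ≡ xs
map-leftInverse {xs = xs} inv = trans (sym (map-∘ xs)) (map-id-local inv)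

Unique-map-leftInverse : {f : A → B} (g : B → A) → All (λ x → g (f x) ≡ x) xs →
  Unique xs → Unique (map f xs)
Unique-map-leftInverse {f = f} g inv u = Unique.map⁻ (subst Unique (sym (map-leftInverse {f = f} {g = g} inv)) u)

NoCommonMonotone-map : (f : A → B) (g : B → A) → All (All (λ x → g (f x) ≡ x)) bs →
  NoCommonMonotone r bs → NoCommonMonotone r (map (map f) bs)
NoCommonMonotone-map f g invs none q q-length monos =
  none (map g q) (trans (length-map g q) q-length) (All.map restore (All.zip (invs , All.map⁻ monos)))
  where
  restore : ∀ {b} → All (λ x → g (f x) ≡ x) b × Monotone (map f b) q → Monotone b (map g q)
  restore (inv , mono) = subst (λ b → Monotone b (map g q)) (map-leftInverse inv) (Monotone-map g mono)

⊆-++⁻ : ∀ (ys : List A) {zs xs} → xs ⊆ ys ++ zs →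
  ∃₂ λ xs₁ xs₂ → xs ≡ xs₁ ++ xs₂ × xs₁ ⊆ ys × xs₂ ⊆ zs
⊆-++⁻ [] τ = [] , _ , refl , [] , τ
⊆-++⁻ (y ∷ ys) (.y ∷ʳ τ) with ⊆-++⁻ ys τ
... | xs₁ , xs₂ , refl , τ₁ , τ₂ = xs₁ , xs₂ , refl , y ∷ʳ τ₁ , τ₂
⊆-++⁻ (y ∷ ys) (refl ∷ τ) with ⊆-++⁻ ys τ
... | xs₁ , xs₂ , refl , τ₁ , τ₂ = y ∷ xs₁ , xs₂ , refl , refl ∷ τ₁ , τ₂

⊆-concat⁻ : ∀ (bs : List (List A)) → t ⊆ concat bs →
  ∃ λ ts → t ≡ concat ts × Pointwise _⊆_ ts bs
⊆-concat⁻ [] [] = [] , refl , []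
⊆-concat⁻ (b ∷ bs) τ with ⊆-++⁻ b τ
... | t₁ , _ , refl , τ₁ , τ₂ with ⊆-concat⁻ bs τ₂
... | ts , refl , τs = t₁ ∷ ts , refl , τ₁ ∷ τs

++-injective : length xs ≡ length ys → xs ++ zs ≡ ys ++ t → xs ≡ ys × zs ≡ t
++-injective {xs = []} {ys = []} _ eq = refl , eq
++-injective {xs = x ∷ xs} {ys = y ∷ ys} len eq with ∷-injective eq
... | refl , eq′ with ++-injective {xs = xs} {ys = ys} (suc-injective len) eq′
... | refl , eq″ = refl , eq″

length-concat≤ : All (λ xs → length xs ≤ r) bs → length (concat bs) ≤ length bs * r
length-concat≤ [] = z≤n
length-concat≤ {bs = xs ∷ _} (xs≤ ∷ xss≤) = ≤-trans (≤-reflexive (length-++ xs)) (+-mono-≤ xs≤ (length-concat≤ xss≤))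

length-concat≡ : All (λ xs → length xs ≡ r) bs → length (concat bs) ≡ length bs * r
length-concat≡ [] = refl
length-concat≡ {bs = xs ∷ _} (xs≡ ∷ xss≡) = trans (length-++ xs) (cong₂ _+_ xs≡ (length-concat≡ xss≡))

concat-aligned : {xss yss : List (List A)} → All (λ xs → length xs ≤ r) xss → All (λ ys → length ys ≡ r) yss →
  length xss ≡ length yss → concat xss ≡ concat yss → xss ≡ yss
concat-aligned [] [] _ _ = refl
concat-aligned {r = r} {xss = xs ∷ xss} {yss = ys ∷ yss} (xs≤ ∷ xss≤) (ys≡ ∷ yss≡) len eq
  with ++-injective {xs = xs} {ys = ys} |xs|≡|ys| eq
  where
  open ≤-Reasoning
  rest≤ : length (concat xss) ≤ length (concat yss)
  rest≤ = begin
    length (concat xss) ≤⟨ length-concat≤ xss≤ ⟩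
    length xss * r      ≡⟨ cong (_* r) (suc-injective len) ⟩
    length yss * r      ≡⟨ length-concat≡ yss≡ ⟨
    length (concat yss) ∎
  r≤|xs| : r ≤ length xs
  r≤|xs| = +-cancelʳ-≤ (length (concat yss)) r (length xs) (begin
    r + length (concat yss)         ≡⟨ cong (_+ length (concat yss)) ys≡ ⟨
    length ys + length (concat yss) ≡⟨ length-++ ys ⟨
    length (concat (ys ∷ yss))      ≡⟨ cong length eq ⟨
    length (concat (xs ∷ xss))      ≡⟨ length-++ xs ⟩
    length xs + length (concat xss) ≤⟨ +-monoʳ-≤ (length xs) rest≤ ⟩
    length xs + length (concat yss) ∎)
  |xs|≡|ys| : length xs ≡ length ys
  |xs|≡|ys| = trans (≤-antisym xs≤ r≤|xs|) (sym ys≡)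
... | refl , eq′ = cong (xs ∷_) (concat-aligned xss≤ yss≡ (suc-injective len) eq′)

_≡±_ : List A → List A → Set
xs ≡± ys = xs ≡ ys ⊎ xs ≡ reverse ys

≡±-sym : xs ≡± ys → ys ≡± xs
≡±-sym (inj₁ refl) = inj₁ refl
≡±-sym (inj₂ refl) = inj₂ (sym (reverse-involutive _))

≡±-trans : xs ≡± ys → ys ≡± zs → xs ≡± zs
≡±-trans (inj₁ refl) e = e
≡±-trans (inj₂ refl) (inj₁ refl) = inj₂ refl
≡±-trans (inj₂ refl) (inj₂ refl) = inj₁ (reverse-involutive _)

≡±-length : xs ≡± ys → length xs ≡ length ys
≡±-length (inj₁ refl) = refl
≡±-length {ys = ys} (inj₂ refl) = length-reverse ys

≡±⇒⊆ : xs ≡± ys → All (_∈ ys) xs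
≡±⇒⊆ (inj₁ refl) = All.tabulate id
≡±⇒⊆ (inj₂ refl) = All.tabulate reverse⁻

Unique-resp-Pointwise-⊆ : Pointwise _⊆_ ts bs → All Unique bs → All Unique ts
Unique-resp-Pointwise-⊆ [] [] = []
Unique-resp-Pointwise-⊆ (τ ∷ τs) (u ∷ us) = AllPairs-resp-⊆ τ u ∷ Unique-resp-Pointwise-⊆ τs us

Pointwise-⊆⇒Monotone : Pointwise _⊆_ ts bs → All (_≡± q) ts → All (λ b → Monotone b q) bs
Pointwise-⊆⇒Monotone [] [] = []
Pointwise-⊆⇒Monotone (τ ∷ τs) (inj₁ refl ∷ es) = ⊆⇒Monotone τ ∷ Pointwise-⊆⇒Monotone τs es
Pointwise-⊆⇒Monotone (τ ∷ τs) (inj₂ refl ∷ es) = reverse⊆⇒Monotone τ ∷ Pointwise-⊆⇒Monotone τs es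

-- Each piece of t maps injectively into the r letters of p, so has at most r letters; as t
-- has exactly s·r letters, the pieces line up with the s copies of p or its reverse.
binaryPieces : {g : A → B} {p : List B} {ts : List (List B)} → All Unique bs → length ts ≡ length bs →
  All (_≡± p) ts → t ⊆ concat bs → InjectiveOn g t → map g t ≡ concat ts →
  ∃ λ pieces → t ≡ concat pieces × Pointwise _⊆_ pieces bs × All (λ t → map g t ≡± p) pieces
binaryPieces {bs = bs} {g = g} {p = p} {ts = ts} bs-unique ts-length ts-binary t⊆ g-inj gt≡u
  with ⊆-concat⁻ bs t⊆
... | pieces , refl , τs = pieces , refl , τs , All.map⁻ (subst (All (_≡± p)) (sym aligned) ts-binary)
  where
  letters : All (λ x → g x ∈ p) (concat pieces)
  letters = All.map⁻ (subst (All (_∈ p)) (sym gt≡u) (All.concat⁺ (All.map ≡±⇒⊆ ts-binary)))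
  piece-length : ∀ {t} → (Unique t × All (_∈ concat pieces) t) × All (λ x → g x ∈ p) t →
    length (map g t) ≤ length p
  piece-length ((u , t∈) , gt∈p) = Unique⇒length≤
    (Unique-map-injectiveOn (λ x∈ y∈ → g-inj (All.lookup t∈ x∈) (All.lookup t∈ y∈)) u)
    (All.map⁺ gt∈p)
  aligned : map (map g) pieces ≡ ts
  aligned = concat-aligned
    (All.map⁺ (All.map piece-length
      (All.zip (All.zip (Unique-resp-Pointwise-⊆ τs bs-unique , All.concat⁻ (All.tabulate id))
              , All.concat⁻ letters))))
    (All.map ≡±-length ts-binary)
    (trans (length-map _ pieces) (trans (Pointwise-length τs) (sym ts-length)))
    (trans (concat-map pieces) gt≡u)

pieces⇒commonMonotone : {g : A → A} → InjectiveOn g (concat ts) → Pointwise _⊆_ ts bs →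
  All (λ t → map g t ≡± p) ts → ∃ λ q → length q ≡ length p × All (λ b → Monotone b q) bs
pieces⇒commonMonotone {p = p} g-inj [] [] = p , refl , []
pieces⇒commonMonotone {ts = t₁ ∷ ts} {p = p} {g = g} g-inj (τ ∷ τs) (e₁ ∷ es) =
  t₁ , trans (sym (length-map g t₁)) (≡±-length e₁) ,
  Pointwise-⊆⇒Monotone (τ ∷ τs) (All.map orient (All.zip (All.concat⁻ (All.tabulate id) , e₁ ∷ es)))
  where
  t₁∈ : All (_∈ concat (t₁ ∷ ts)) t₁
  t₁∈ = All.tabulate ∈-++⁺ˡ
  orient : ∀ {t} → All (_∈ concat (t₁ ∷ ts)) t × map g t ≡± p → t ≡± t₁
  orient (t∈ , e) with ≡±-trans e (≡±-sym e₁)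
  ... | inj₁ eq = inj₁ (map-injectiveOn g-inj t∈ t₁∈ eq)
  ... | inj₂ eq = inj₂ (map-injectiveOn g-inj t∈ (All.tabulate (All.lookup t₁∈ ∘ reverse⁻))
                                          (trans eq (sym (reverse-map g t₁))))

binaryContainment⇒commonMonotone : ∀ {s u} {bs : List (List ℕ)} → All Unique bs → length bs ≡ s →
  IsBinaryFormation r s u → Contains (concat bs) u → ∃ λ q → length q ≡ r × All (λ b → Monotone b q) bs
binaryContainment⇒commonMonotone bs-unique bs-length
  (p , _ , refl , ps , ps-length , ps-binary , refl) (t , t⊆ , g , gt≡u , g-inj)
  with binaryPieces bs-unique (trans ps-length (sym bs-length)) ps-binary t⊆ g-inj gt≡u
... | pieces , refl , τs , pieces-binary = pieces⇒commonMonotone g-inj τs pieces-binary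

∈-map-pair⇒proj₁≡ : {Y : List B} {z : A × B} → z ∈ map (a ,_) Y → proj₁ z ≡ a
∈-map-pair⇒proj₁≡ {a = a} z∈ with ∈-map⁻ (a ,_) z∈
... | _ , _ , refl = refl

Before-cartesianProduct⁻ : ∀ (X : List A) {Y : List B} {x y : A × B} → Before (cartesianProduct X Y) x y →
  Before X (proj₁ x) (proj₁ y) ⊎ (proj₁ x ≡ proj₁ y × Before Y (proj₂ x) (proj₂ y))
Before-cartesianProduct⁻ [] ()
Before-cartesianProduct⁻ (a ∷ X) {Y} τ with ⊆-++⁻ (map (a ,_) Y) τ
... | [] , _ , refl , _ , τ₂ with Before-cartesianProduct⁻ X τ₂
...   | inj₁ σ = inj₁ (a ∷ʳ σ)
...   | inj₂ σ = inj₂ σ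
Before-cartesianProduct⁻ (a ∷ X) {Y} τ | _ ∷ [] , _ ∷ [] , refl , τ₁ , τ₂ =
  inj₁ (∈-map-pair⇒proj₁≡ (to∈ τ₁) ∷ from∈ (proj₁ (∈-cartesianProduct⁻ X Y (to∈ τ₂))))
Before-cartesianProduct⁻ (a ∷ X) {Y} τ | _ ∷ _ ∷ [] , [] , refl , τ₁ , _ =
  inj₂ (trans (∈-map-pair⇒proj₁≡ (to∈ τ₁)) (sym (∈-map-pair⇒proj₁≡ (to∈ (∷ˡ⁻ τ₁)))) ,
        subst (_ ⊆_) (map-leftInverse (All.tabulate (λ _ → refl))) (map⁺ proj₂ τ₁))

Ordered-cartesianProduct⁻ : ∀ o (X : List A) {Y : List B} {x y : A × B} → Ordered (cartesianProduct X Y) o x y →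
  Ordered X o (proj₁ x) (proj₁ y) ⊎ (proj₁ x ≡ proj₁ y × Ordered Y o (proj₂ x) (proj₂ y))
Ordered-cartesianProduct⁻ true X τ = Before-cartesianProduct⁻ X τ
Ordered-cartesianProduct⁻ false X τ with Before-cartesianProduct⁻ X τ
... | inj₁ σ = inj₁ σ
... | inj₂ (e , σ) = inj₂ (sym e , σ)

Ordered-cartesianProduct-proj₁ : ∀ o (X : List A) {Y : List B} {x y : A × B} → proj₁ x ≢ proj₁ y →
  Ordered (cartesianProduct X Y) o x y → Ordered X o (proj₁ x) (proj₁ y)
Ordered-cartesianProduct-proj₁ o X x₁≢y₁ τ with Ordered-cartesianProduct⁻ o X τ
... | inj₁ σ = σ
... | inj₂ (x₁≡y₁ , _) = ⊥-elim (x₁≢y₁ x₁≡y₁)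

Ordered-cartesianProduct-proj₂ : ∀ o {X : List A} {Y : List B} {x y : A × B} → Unique X → proj₁ x ≡ proj₁ y →
  Ordered (cartesianProduct X Y) o x y → Ordered Y o (proj₂ x) (proj₂ y)
Ordered-cartesianProduct-proj₂ o {X} u x₁≡y₁ τ with Ordered-cartesianProduct⁻ o X τ
... | inj₁ σ = ⊥-elim (Ordered⇒≢ o u σ x₁≡y₁)
... | inj₂ (_ , σ) = σ

Monotone-proj₁ : ∀ (X : List A) (Y : List B) {q} → AllPairs (λ x y → proj₁ x ≢ proj₁ y) q →
  Monotone (cartesianProduct X Y) q → Monotone X (map proj₁ q)
Monotone-proj₁ X Y ≢s (q∈ , o , ord) =
  All.map⁺ (All.map (proj₁ ∘ ∈-cartesianProduct⁻ X Y) q∈) , o ,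
  AllPairs.map⁺ (AllPairs.zipWith (λ (x₁≢y₁ , τ) → Ordered-cartesianProduct-proj₁ o X x₁≢y₁ τ) (≢s , ord))

Monotone-proj₂ : ∀ (X : List A) (Y : List B) {q} → Unique X → AllPairs (λ x y → proj₁ x ≡ proj₁ y) q →
  Monotone (cartesianProduct X Y) q → Monotone Y (map proj₂ q)
Monotone-proj₂ X Y u ≡s (q∈ , o , ord) =
  All.map⁺ (All.map (proj₂ ∘ ∈-cartesianProduct⁻ X Y) q∈) , o ,
  AllPairs.map⁺ (AllPairs.zipWith (λ (x₁≡y₁ , τ) → Ordered-cartesianProduct-proj₂ o u x₁≡y₁ τ) (≡s , ord))

square : List A → List (List A) → List (List (A × A))
square X bs = cartesianProduct X (reverse X) ∷ map (λ B → cartesianProduct B B) bs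

module _ {X : List A} (X-unique : Unique X) where

  sameOrientation⇒proj₁≢ : ∀ o {x y : A × A} → Ordered (cartesianProduct X (reverse X)) o x y →
    Ordered (cartesianProduct X X) o x y → proj₁ x ≢ proj₁ y
  sameOrientation⇒proj₁≢ o τ₀ τ₁ x₁≡y₁ = Ordered-not o X-unique
    (Ordered-cartesianProduct-proj₂ o X-unique x₁≡y₁ τ₁)
    (Ordered-reverse o (Ordered-cartesianProduct-proj₂ o X-unique x₁≡y₁ τ₀))

  oppositeOrientation⇒proj₁≡ : ∀ o {x y : A × A} → Ordered (cartesianProduct X (reverse X)) (not o) x y →
    Ordered (cartesianProduct X X) o x y → proj₁ x ≡ proj₁ y
  oppositeOrientation⇒proj₁≡ o τ₀ τ₁ with Ordered-cartesianProduct⁻ o X τ₁ | Ordered-cartesianProduct⁻ (not o) X τ₀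
  ... | inj₂ (x₁≡y₁ , _) | _ = x₁≡y₁
  ... | inj₁ _ | inj₂ (x₁≡y₁ , _) = x₁≡y₁
  ... | inj₁ σ₁ | inj₁ σ₀ = ⊥-elim (Ordered-not o X-unique σ₁ σ₀)

  square-noCommonMonotone : X ∈ bs → All Unique bs → NoCommonMonotone r bs → NoCommonMonotone r (square X bs)
  square-noCommonMonotone {bs = bs} X∈bs bs-unique none q q-length ((_ , o₀ , ord₀) ∷ monos)
    with All.lookup (All.map⁻ monos) X∈bs
  ... | _ , o₁ , ord₁ = orientations o₀ o₁ ord₀ ord₁
    where
    monos′ : All (λ B → Monotone (cartesianProduct B B) q) bs
    monos′ = All.map⁻ monos
    same : ∀ o → AllPairs (Ordered (cartesianProduct X (reverse X)) o) q →
      AllPairs (Ordered (cartesianProduct X X) o) q → ⊥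
    same o ord₀ ord₁ = none (map proj₁ q) (trans (length-map proj₁ q) q-length)
      (All.map (Monotone-proj₁ _ _ (AllPairs.zipWith (λ (τ₀ , τ₁) → sameOrientation⇒proj₁≢ o τ₀ τ₁) (ord₀ , ord₁)))
               monos′)
    opposite : ∀ o → AllPairs (Ordered (cartesianProduct X (reverse X)) (not o)) q →
      AllPairs (Ordered (cartesianProduct X X) o) q → ⊥
    opposite o ord₀ ord₁ = none (map proj₂ q) (trans (length-map proj₂ q) q-length)
      (All.zipWith (λ (u , mono) → Monotone-proj₂ _ _ u
                     (AllPairs.zipWith (λ (τ₀ , τ₁) → oppositeOrientation⇒proj₁≡ o τ₀ τ₁) (ord₀ , ord₁)) mono)
                   (bs-unique , monos′))
    orientations : ∀ o₀ o₁ → AllPairs (Ordered (cartesianProduct X (reverse X)) o₀) q →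
      AllPairs (Ordered (cartesianProduct X X) o₁) q → ⊥
    orientations true  true  = same true
    orientations false false = same false
    orientations true  false = opposite false
    orientations false true  = opposite true

length-cartesianProduct : ∀ (X : List A) (Y : List B) → length (cartesianProduct X Y) ≡ length X * length Y
length-cartesianProduct [] Y = refl
length-cartesianProduct (a ∷ X) Y =
  trans (length-++ (map (a ,_) Y)) (cong₂ _+_ (length-map (a ,_) Y) (length-cartesianProduct X Y))

cartesianProduct-↭ʳ : ∀ (X : List A) {Y Y′ : List B} → Y ↭ Y′ → cartesianProduct X Y ↭ cartesianProduct X Y′
cartesianProduct-↭ʳ [] _ = ↭-refl
cartesianProduct-↭ʳ (a ∷ X) Y↭Y′ = ↭.++⁺ (↭.map⁺ (a ,_) Y↭Y′) (cartesianProduct-↭ʳ X Y↭Y′)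

cartesianProduct-↭ˡ : ∀ {X X′ : List A} (Y : List B) → X ↭ X′ → cartesianProduct X Y ↭ cartesianProduct X′ Y
cartesianProduct-↭ˡ Y ↭.refl = ↭-refl
cartesianProduct-↭ˡ Y (prep a X↭X′) = ↭.++⁺ˡ (map (a ,_) Y) (cartesianProduct-↭ˡ Y X↭X′)
cartesianProduct-↭ˡ Y (swap a b X↭X′) = ↭.trans
  (↭.shifts (map (a ,_) Y) (map (b ,_) Y))
  (↭.++⁺ˡ (map (b ,_) Y) (↭.++⁺ˡ (map (a ,_) Y) (cartesianProduct-↭ˡ Y X↭X′)))
cartesianProduct-↭ˡ Y (↭.trans X↭X″ X″↭X′) = ↭.trans (cartesianProduct-↭ˡ Y X↭X″) (cartesianProduct-↭ˡ Y X″↭X′)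

cartesianProduct-↭ : {X X′ : List A} {Y Y′ : List B} → X ↭ X′ → Y ↭ Y′ →
  cartesianProduct X Y ↭ cartesianProduct X′ Y′
cartesianProduct-↭ {X′ = X′} {Y = Y} X↭X′ Y↭Y′ = ↭.trans (cartesianProduct-↭ˡ Y X↭X′) (cartesianProduct-↭ʳ X′ Y↭Y′)

Unique-resp-↭ : Unique xs → xs ↭ ys → Unique ys
Unique-resp-↭ u xs↭ys = ↭ₛ.Unique-resp-↭ (setoid _) (↭⇒↭ₛ xs↭ys) u

module Encoding (K : ℕ) .{{_ : NonZero K}} where

  encode : ℕ × ℕ → ℕ
  encode (a , b) = b + a * K

  decode : ℕ → ℕ × ℕ
  decode n = n / K , n % K

  decode-encode : ∀ {a b} → b < K → decode (encode (a , b)) ≡ (a , b)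
  decode-encode {a} {b} b<K = cong₂ _,_ quotient (trans ([m+kn]%n≡m%n b a K) (m<n⇒m%n≡m b<K))
    where
    open ≡-Reasoning
    quotient : (b + a * K) / K ≡ a
    quotient = begin
      (b + a * K) / K     ≡⟨ +-distrib-/-∣ʳ b (n∣m*n a) ⟩
      b / K + a * K / K   ≡⟨ cong₂ _+_ (m<n⇒m/n≡0 b<K) (m*n/n≡m a K) ⟩
      a                   ∎

  encode-< : ∀ {a b} → a < K → b < K → encode (a , b) < K * K
  encode-< {a} {b} a<K b<K = ≤-trans (+-monoˡ-< (a * K) b<K) (*-monoˡ-≤ K a<K)

  decode-encode-cartesianProduct : ∀ X {Y} → All (_< K) Y →
    All (λ xy → decode (encode xy) ≡ xy) (cartesianProduct X Y)
  decode-encode-cartesianProduct X {Y} Y<K =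
    All.tabulate (λ xy∈ → decode-encode (All.lookup Y<K (proj₂ (∈-cartesianProduct⁻ X Y xy∈))))

  encode-cartesianProduct-< : ∀ {X Y} → All (_< K) X → All (_< K) Y → All (_< K * K) (map encode (cartesianProduct X Y))
  encode-cartesianProduct-< {X} {Y} X<K Y<K = All.map⁺ (All.tabulate (λ xy∈ →
    let (x∈ , y∈) = ∈-cartesianProduct⁻ X Y xy∈ in encode-< (All.lookup X<K x∈) (All.lookup Y<K y∈)))

record Stage (k n : ℕ) : Set where
  field
    radix : ℕ
    {{radix≢0}} : NonZero radix
    ground : List ℕ
    blocks : List (List ℕ)
    ground-unique : Unique ground
    ground-length : length ground ≡ k ^ (2 ^ n)
    ground<radix : All (_< radix) ground
    ground∈blocks : ground ∈ blocks
    blocks↭ground : All (_↭ ground) blocks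
    blocks-length : length blocks ≡ suc n
    noCommonMonotone : NoCommonMonotone (suc k) blocks

  blocks-unique : All Unique blocks
  blocks-unique = All.map (λ B↭ground → Unique-resp-↭ ground-unique (↭-sym B↭ground)) blocks↭ground

  blocks<radix : All (All (_< radix)) blocks
  blocks<radix = All.map (λ B↭ground → ↭.All-resp-↭ (↭-sym B↭ground) ground<radix) blocks↭ground

initial : ∀ k → Stage k 0
initial k = record
  { radix = suc k
  ; ground = upTo k
  ; blocks = upTo k ∷ []
  ; ground-unique = Unique.upTo⁺ k
  ; ground-length = trans (length-upTo k) (sym (*-identityʳ k))
  ; ground<radix = All.tabulate (m<n⇒m<1+n ∘ ∈-upTo⁻)
  ; ground∈blocks = here refl
  ; blocks↭ground = ↭-refl ∷ []
  ; blocks-length = refl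
  ; noCommonMonotone = singleton-noCommonMonotone (Unique.upTo⁺ k) (s≤s (≤-reflexive (length-upTo k)))
  }

next : ∀ {k n} → Stage k n → Stage k (suc n)
next {k} {n} S = record
  { radix = radix * radix
  ; radix≢0 = m*n≢0 radix radix
  ; ground = map encode (cartesianProduct ground ground)
  ; blocks = map (map encode) (square ground blocks)
  ; ground-unique = Unique-map-leftInverse decode (decode-encode-cartesianProduct ground ground<radix)
      (Unique.cartesianProduct⁺ ground-unique ground-unique)
  ; ground-length = begin
      length (map encode (cartesianProduct ground ground))  ≡⟨ length-map encode (cartesianProduct ground ground) ⟩
      length (cartesianProduct ground ground)               ≡⟨ length-cartesianProduct ground ground ⟩
      length ground * length ground                         ≡⟨ cong₂ _*_ ground-length ground-length ⟩
      k ^ (2 ^ n) * k ^ (2 ^ n)                             ≡⟨ ^-distribˡ-+-* k (2 ^ n) (2 ^ n) ⟨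
      k ^ (2 ^ n + 2 ^ n)                                   ≡⟨ cong (λ m → k ^ (2 ^ n + m)) (+-identityʳ (2 ^ n)) ⟨
      k ^ (2 ^ suc n)                                       ∎
  ; ground<radix = encode-cartesianProduct-< ground<radix ground<radix
  ; ground∈blocks = ∈-map⁺ (map encode) (there (∈-map⁺ (λ B → cartesianProduct B B) ground∈blocks))
  ; blocks↭ground = All.map⁺ (All.map (↭.map⁺ encode)
      (cartesianProduct-↭ʳ ground (↭.↭-reverse ground)
       ∷ All.map⁺ (All.map (λ B↭ground → cartesianProduct-↭ B↭ground B↭ground) blocks↭ground)))
  ; blocks-length = trans (length-map (map encode) (square ground blocks))
      (cong suc (trans (length-map (λ B → cartesianProduct B B) blocks) blocks-length))
  ; noCommonMonotone = NoCommonMonotone-map encode decode decodable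
      (square-noCommonMonotone ground-unique ground∈blocks blocks-unique noCommonMonotone)
  }
  where
  open Stage S
  open Encoding radix
  open ≡-Reasoning
  decodable : All (All (λ xy → decode (encode xy) ≡ xy)) (square ground blocks)
  decodable = decode-encode-cartesianProduct ground (↭.All-resp-↭ (↭-sym (↭.↭-reverse ground)) ground<radix)
    ∷ All.map⁺ (All.map (λ {B} → decode-encode-cartesianProduct B) blocks<radix)

stage : ∀ k n → Stage k n
stage k zero = initial k
stage k (suc n) = next (stage k n)

theorem2p5 : (r s : ℕ) → r ≥ 1 → s ≥ 1 →
    Σ Seq λ f → IsFormation ((r ∸ 1) ^ (2 ^ (s ∸ 1))) s f ×
      ((u : Seq) → IsBinaryFormation r s u → Avoids f u)
theorem2p5 (suc k) (suc n) _ _ =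
  concat blocks ,
  (ground , ground-unique , ground-length , blocks , blocks-length , blocks↭ground , refl) ,
  λ u binary contains →
    let q , q-length , monos = binaryContainment⇒commonMonotone blocks-unique blocks-length binary contains
    in noCommonMonotone q q-length monos
  where open Stage (stage k n)
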